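{- For every integer $d \ge 0$ and every integer $k$ with $0 \le k \le d$, the sum of all entries of $S_d$ that are equal to $2^k$ is $2^d$, i.e. $$\sum_{1\le i\le n_d:\ S_d[i]=2^k} 2^k = 2^d .$$
   Context: Define finite integer sequences $S_k$, $k=0,1,2,\dots$, recursively by $S_0=\langle 1\rangle$ and $S_k = S_{k-1}\,\|\,S_{k-1}\,\|\,\langle 2^k\rangle$ for $k>0$, where $\|$ denotes concatenation (so $S_1=\langle 1,1,2\rangle$, $S_2=\langle 1,1,2,1,1,2,4\rangle$). Let $n_k$ be the length of $S_k$ and $S_k[i]$ its $i$-th entry ($1\le i\le n_k$). -}

module Defs where

open import Data.Nat using (ℕ; zero; suc; _^_; _≟_)
open import Data.List using (List; [_]; _++_; filter)
open import Data.Nat.ListAction using (sum)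

S : ℕ → List ℕ
S zero = [ 1 ]
S (suc k) = S k ++ S k ++ [ 2 ^ suc k ]

sumEqualTo : ℕ → List ℕ → ℕ
sumEqualTo v xs = sum (filter (_≟ v) xs)

-- Each occurrence of a power 2^k with k ≤ d doubles when passing from S d to
-- S (suc d), and the new last entry 2^(suc d) exceeds every entry of S d.
-- So the 2^k-mass of S d is the 2^k-mass 2^k of S k doubled d − k times.
module Submission where

open import Defs
open import Data.Nat using (ℕ; zero; suc; _^_; _≤_; _<_; _+_; _≟_; z≤n; s≤s)
open import Data.Nat.Properties using (+-identityʳ; <⇒≢; >⇒≢; <-trans; n<1+n; ^-monoʳ-<; m≤n⇒m<n∨m≡n)
open import Data.List using (List; []; [_]; _++_; filter)
open import Data.List.Properties using (filter-++; filter-accept; filter-reject)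
open import Data.Nat.ListAction using (sum)
open import Data.Nat.ListAction.Properties using (sum-++)
open import Data.Sum using (inj₁; inj₂)
open import Relation.Binary.PropositionalEquality using (_≡_; _≢_; refl; cong; trans)

sumEqualTo-++ : ∀ v xs ys → sumEqualTo v (xs ++ ys) ≡ sumEqualTo v xs + sumEqualTo v ys
sumEqualTo-++ v xs ys =
  trans (cong sum (filter-++ (_≟ v) xs ys)) (sum-++ (filter (_≟ v) xs) (filter (_≟ v) ys))

sumEqualTo-[v] : ∀ v → sumEqualTo v [ v ] ≡ v
sumEqualTo-[v] v = trans (cong sum (filter-accept (_≟ v) {v} {[]} refl)) (+-identityʳ v)

sumEqualTo-[x]-≢ : ∀ {v x} → x ≢ v → sumEqualTo v [ x ] ≡ 0
sumEqualTo-[x]-≢ {v} {x} x≢v = cong sum (filter-reject (_≟ v) {x} {[]} x≢v)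

sumEqualTo-S-suc : ∀ v d →
  sumEqualTo v (S (suc d)) ≡ sumEqualTo v (S d) + (sumEqualTo v (S d) + sumEqualTo v [ 2 ^ suc d ])
sumEqualTo-S-suc v d =
  trans (sumEqualTo-++ v (S d) _) (cong (sumEqualTo v (S d) +_) (sumEqualTo-++ v (S d) _))

2^-< : ∀ {m n} → m < n → 2 ^ m < 2 ^ n
2^-< = ^-monoʳ-< 2 (s≤s (s≤s z≤n))

sumEqualTo-S-above : ∀ d v → 2 ^ d < v → sumEqualTo v (S d) ≡ 0
sumEqualTo-S-above zero v 1<v = sumEqualTo-[x]-≢ (<⇒≢ 1<v)
sumEqualTo-S-above (suc d) v 2^d+1<v
  rewrite sumEqualTo-S-suc v d
        | sumEqualTo-S-above d v (<-trans (2^-< (n<1+n d)) 2^d+1<v)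
        | sumEqualTo-[x]-≢ (<⇒≢ 2^d+1<v) = refl

mainTheorem1 : (d k : ℕ) → k ≤ d → sumEqualTo (2 ^ k) (S d) ≡ 2 ^ d
mainTheorem1 zero zero _ = refl
mainTheorem1 (suc d) k k≤d+1 with m≤n⇒m<n∨m≡n k≤d+1
... | inj₂ refl
  rewrite sumEqualTo-S-suc (2 ^ suc d) d
        | sumEqualTo-S-above d (2 ^ suc d) (2^-< (n<1+n d))
        | sumEqualTo-[v] (2 ^ suc d) = refl
... | inj₁ (s≤s k≤d)
  rewrite sumEqualTo-S-suc (2 ^ k) d
        | mainTheorem1 d k k≤d
        | sumEqualTo-[x]-≢ (>⇒≢ (2^-< (s≤s k≤d))) = refl
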